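{- Let $G=(C\cup S,E)$ be a finite bipartite graph in which every client has at least one neighbor, and let $G'$ be obtained by adding a new client $c$ (with at least one neighbor in $S$) together with its incident edges. Let $\alpha^{\mathrm{old}}$ and $\alpha^{\mathrm{new}}$ be the unique balanced server flows of $G$ and $G'$. Then $\alpha^{\mathrm{new}}(s)=\alpha^{\mathrm{old}}(s)$ for every $s\in S$ with $\alpha^{\mathrm{old}}(s)<\min_{v\in N(c)}\alpha^{\mathrm{old}}(v)$.
   Context: A server flow is a map $\alpha:S\to\mathbb R_{\ge0}$ for which there exist nonnegative reals $(x_e)_{e\in E}$ with $\sum_{s\in N(c)}x_{cs}=1$ for every client $c$ and $\sum_{c\in N(s)}x_{cs}=\alpha(s)$ for every $s\in S$. It is balanced if such $x$ can be chosen with $x_{cs}=0$ whenever $s\in N(c)\setminus\arg\min_{s'\in N(c)}\alpha(s')$. The values of a balanced server flow exist and are unique when every client has a neighbor.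
   Formalization: The balanced server flows $\alpha^{\mathrm{old}}$ and $\alpha^{\mathrm{new}}$, together with the edge weights realizing them, take rational values rather than nonnegative real ones. -}

module Defs where

open import Data.Nat using (ℕ; zero; suc)
open import Data.Fin using (Fin; zero; suc)
open import Data.Bool using (Bool; true; false)
open import Data.Rational using (ℚ; 0ℚ; 1ℚ; _+_; _≤_; _<_)
open import Data.Product using (Σ; ∃; _×_)
open import Data.Sum using (_⊎_)
open import Relation.Binary.PropositionalEquality using (_≡_)

sumFin : (n : ℕ) → (Fin n → ℚ) → ℚ
sumFin zero    f = 0ℚ
sumFin (suc n) f = f zero + sumFin n (λ i → f (suc i))

-- A bipartite graph with clients Fin m and servers Fin k, given by its
-- adjacency (edge cs present iff adj c s ≡ true).
Graph : ℕ → ℕ → Set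
Graph m k = Fin m → Fin k → Bool

EveryClientHasNeighbour : ∀ {m k} → Graph m k → Set
EveryClientHasNeighbour {m} {k} adj = ∀ (c : Fin m) → ∃ λ (s : Fin k) → adj c s ≡ true

-- x is a witness that α is a server flow: x is nonnegative, supported on
-- edges (x_e only exists for e ∈ E), each client sends total 1 and each
-- server s receives α s.
IsFlowWitness : ∀ {m k} → Graph m k → (Fin k → ℚ) → (Fin m → Fin k → ℚ) → Set
IsFlowWitness {m} {k} adj α x =
  (∀ c s → 0ℚ ≤ x c s)
  × (∀ c s → adj c s ≡ false → x c s ≡ 0ℚ)
  × (∀ c → sumFin k (λ s → x c s) ≡ 1ℚ)
  × (∀ s → sumFin m (λ c → x c s) ≡ α s)

IsServerFlow : ∀ {m k} → Graph m k → (Fin k → ℚ) → Set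
IsServerFlow {m} {k} adj α = Σ (Fin m → Fin k → ℚ) λ x → IsFlowWitness adj α x

IsBalancedServerFlow : ∀ {m k} → Graph m k → (Fin k → ℚ) → Set
IsBalancedServerFlow {m} {k} adj α =
  Σ (Fin m → Fin k → ℚ) λ x →
    IsFlowWitness adj α x
    × (∀ c s → adj c s ≡ true →
         x c s ≡ 0ℚ ⊎ (∀ s' → adj c s' ≡ true → α s ≤ α s'))

-- For loads α, β and a threshold t, let D be the set of servers s with β s < α s
-- and β s ≤ t.  If a client of a balanced α-flow sends anything into D, then every
-- β-argmin of its neighbourhood lies in D, so in a balanced β-flow it sends all of
-- its unit into D.  Client by client the β-flow thus puts at least as much into D,
-- so β(D) ≥ α(D), which forces D = ∅.  With α = αold, β = αnew (the new client only
-- adds mass) this gives αold ≤ αnew; with α = αnew, β = αold and t = αold s, where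
-- the new client cannot reach D since all its neighbours are heavier than s, it
-- gives αnew s ≤ αold s.
{-# OPTIONS --safe #-}
module Submission where

open import Defs
open import Data.Nat using (ℕ; suc)
open import Data.Fin using (Fin; zero; suc)
open import Data.Fin.Properties using (any?)
open import Data.Bool using (Bool; true; false; if_then_else_)
open import Data.Rational using (ℚ; 0ℚ; 1ℚ; _+_; _≤_; _<_)
open import Data.Rational.Properties
  using ( ≤-refl; ≤-trans; ≤-antisym; <⇒≤; ≮⇒≥; <-irrefl; <-≤-trans; ≤-<-trans
        ; _≤?_; _<?_; +-mono-≤; +-mono-<-≤; +-mono-≤-<; +-identityˡ
        ; +-0-commutativeMonoid; module ≤-Reasoning )
open import Algebra.Properties.CommutativeMonoid.Sum +-0-commutativeMonoid
  using (sum; sum-cong-≗; sum-replicate-zero; ∑-comm)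
open import Data.Product using (∃; _×_; _,_; proj₁)
open import Data.Sum using (inj₁; inj₂)
open import Function using (_∘_)
open import Relation.Nullary using (¬_; does; yes; no; contradiction)
open import Relation.Nullary.Decidable using (_×-dec_)
open import Level using (0ℓ)
open import Relation.Unary using (Pred; Decidable)
open import Relation.Binary.PropositionalEquality
  using (_≡_; _≗_; refl; sym; trans; cong; subst₂; module ≡-Reasoning)

private
  variable
    m k : ℕ

sumFin≗sum : ∀ n (f : Fin n → ℚ) → sumFin n f ≡ sum f
sumFin≗sum ℕ.zero    f = refl
sumFin≗sum (ℕ.suc n) f = cong (f zero +_) (sumFin≗sum n (f ∘ suc))

sumFin-cong : ∀ n {f g : Fin n → ℚ} → f ≗ g → sumFin n f ≡ sumFin n g
sumFin-cong n {f} {g} f≗g = begin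
  sumFin n f  ≡⟨ sumFin≗sum n f ⟩
  sum f       ≡⟨ sum-cong-≗ f≗g ⟩
  sum g       ≡⟨ sumFin≗sum n g ⟨
  sumFin n g  ∎
  where open ≡-Reasoning

sumFin-zero : ∀ n → sumFin n (λ _ → 0ℚ) ≡ 0ℚ
sumFin-zero n = trans (sumFin≗sum n _) (sum-replicate-zero n)

sumFin-comm : ∀ m n (f : Fin m → Fin n → ℚ) →
  sumFin m (λ i → sumFin n (f i)) ≡ sumFin n (λ j → sumFin m (λ i → f i j))
sumFin-comm m n f = begin
  sumFin m (λ i → sumFin n (f i))      ≡⟨ sumFin≗sum m _ ⟩
  sum (λ i → sumFin n (f i))           ≡⟨ sum-cong-≗ (λ i → sumFin≗sum n (f i)) ⟩
  sum (λ i → sum (f i))                ≡⟨ ∑-comm f ⟩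
  sum (λ j → sum (λ i → f i j))        ≡⟨ sum-cong-≗ (λ j → sumFin≗sum m (λ i → f i j)) ⟨
  sum (λ j → sumFin m (λ i → f i j))   ≡⟨ sumFin≗sum n _ ⟨
  sumFin n (λ j → sumFin m (λ i → f i j)) ∎
  where open ≡-Reasoning

sumFin-mono-≤ : ∀ n {f g : Fin n → ℚ} → (∀ i → f i ≤ g i) → sumFin n f ≤ sumFin n g
sumFin-mono-≤ ℕ.zero    f≤g = ≤-refl
sumFin-mono-≤ (ℕ.suc n) f≤g = +-mono-≤ (f≤g zero) (sumFin-mono-≤ n (f≤g ∘ suc))

sumFin-mono-< : ∀ n {f g : Fin n → ℚ} → (∀ i → f i ≤ g i) → ∀ j → f j < g j →
  sumFin n f < sumFin n g
sumFin-mono-< (ℕ.suc n) f≤g zero    fj<gj =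
  +-mono-<-≤ fj<gj (sumFin-mono-≤ n (f≤g ∘ suc))
sumFin-mono-< (ℕ.suc n) f≤g (suc j) fj<gj =
  +-mono-≤-< (f≤g zero) (sumFin-mono-< n (f≤g ∘ suc) j fj<gj)

module Restricted {k} {P : Pred (Fin k) 0ℓ} (P? : Decidable P) where

  restrict : (Fin k → ℚ) → Fin k → ℚ
  restrict f s = if does (P? s) then f s else 0ℚ

  sumOver : (Fin k → ℚ) → ℚ
  sumOver f = sumFin k (restrict f)

  restrict-mono-≤ : ∀ {f g} → (∀ s → P s → f s ≤ g s) → ∀ s → restrict f s ≤ restrict g s
  restrict-mono-≤ f≤g s with P? s
  ... | yes p = f≤g s p
  ... | no _  = ≤-refl

  sumOver-mono-≤ : ∀ {f g} → (∀ s → P s → f s ≤ g s) → sumOver f ≤ sumOver g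
  sumOver-mono-≤ f≤g = sumFin-mono-≤ k (restrict-mono-≤ f≤g)

  sumOver-mono-< : ∀ {f g} → (∀ s → P s → f s < g s) → ∀ {s₀} → P s₀ → sumOver f < sumOver g
  sumOver-mono-< {f} {g} f<g {s₀} p₀ =
    sumFin-mono-< k (restrict-mono-≤ (λ s → <⇒≤ ∘ f<g s)) s₀ strict
    where
    strict : restrict f s₀ < restrict g s₀
    strict with P? s₀
    ... | yes p  = f<g s₀ p
    ... | no ¬p₀ = contradiction p₀ ¬p₀

  sumOver-≤-sumFin : ∀ {f} → (∀ s → ¬ P s → 0ℚ ≤ f s) → sumOver f ≤ sumFin k f
  sumOver-≤-sumFin {f} f≥0 = sumFin-mono-≤ k pointwise
    where
    pointwise : ∀ s → restrict f s ≤ f s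
    pointwise s with P? s
    ... | yes _ = ≤-refl
    ... | no ¬p = f≥0 s ¬p

  sumFin-≤-sumOver : ∀ {f} → (∀ s → ¬ P s → f s ≤ 0ℚ) → sumFin k f ≤ sumOver f
  sumFin-≤-sumOver {f} f≤0 = sumFin-mono-≤ k pointwise
    where
    pointwise : ∀ s → f s ≤ restrict f s
    pointwise s with P? s
    ... | yes _ = ≤-refl
    ... | no ¬p = f≤0 s ¬p

  sumOver-loads : ∀ n {x : Fin n → Fin k → ℚ} {α : Fin k → ℚ} →
    (∀ s → sumFin n (λ c → x c s) ≡ α s) → sumFin n (λ c → sumOver (x c)) ≡ sumOver α
  sumOver-loads n {x} {α} x-loads = trans (sumFin-comm n k (restrict ∘ x)) (sumFin-cong k pointwise)
    where
    pointwise : ∀ s → sumFin n (λ c → restrict (x c) s) ≡ restrict α s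
    pointwise s with P? s
    ... | yes _ = x-loads s
    ... | no _  = sumFin-zero n

  sumOver-loads-≤ : ∀ {n} {x y : Fin n → Fin k → ℚ} {α β : Fin k → ℚ} →
    (∀ s → sumFin n (λ c → x c s) ≡ α s) → (∀ s → sumFin n (λ c → y c s) ≡ β s) →
    (∀ c → sumOver (x c) ≤ sumOver (y c)) → sumOver α ≤ sumOver β
  sumOver-loads-≤ {n} x-loads y-loads x≤y =
    subst₂ _≤_ (sumOver-loads n x-loads) (sumOver-loads n y-loads) (sumFin-mono-≤ n x≤y)

IsArgminOn : (Fin k → Bool) → (Fin k → ℚ) → Fin k → Set
IsArgminOn N α s = N s ≡ true × (∀ s' → N s' ≡ true → α s ≤ α s')

record IsBalancedRow (N : Fin k → Bool) (α : Fin k → ℚ) (r : Fin k → ℚ) : Set where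
  field
    nonneg : ∀ s → 0ℚ ≤ r s
    total  : sumFin k r ≡ 1ℚ
    argmin : ∀ s → 0ℚ < r s → IsArgminOn N α s

open IsBalancedRow

module _ {adj : Graph m k} {α : Fin k → ℚ} where

  flow : IsBalancedServerFlow adj α → Fin m → Fin k → ℚ
  flow = proj₁

  flow-loads : (F : IsBalancedServerFlow adj α) → ∀ s → sumFin m (λ c → flow F c s) ≡ α s
  flow-loads (_ , (_ , _ , _ , loads) , _) = loads

  flow-row : (F : IsBalancedServerFlow adj α) → ∀ c → IsBalancedRow (adj c) α (flow F c)
  flow-row (x , (x≥0 , x-off-edges , x-rows , _) , x-balanced) c = record
    { nonneg = x≥0 c ; total = x-rows c ; argmin = x-argmin }
    where
    x-argmin : ∀ s → 0ℚ < x c s → IsArgminOn (adj c) α s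
    x-argmin s x>0 with adj c s in edge
    ... | false = contradiction x>0 (<-irrefl (sym (x-off-edges c s edge)))
    ... | true with x-balanced c s edge
    ...   | inj₁ x≡0 = contradiction x>0 (<-irrefl (sym x≡0))
    ...   | inj₂ min = refl , min

module LoadDrop (α β : Fin k → ℚ) (t : ℚ) where

  Dropped : Pred (Fin k) 0ℓ
  Dropped s = β s < α s × β s ≤ t

  dropped? : Decidable Dropped
  dropped? s = (β s <? α s) ×-dec (β s ≤? t)

  open Restricted dropped? public

  argmin-dropped : ∀ {N s s'} → IsArgminOn N α s → Dropped s → IsArgminOn N β s' → Dropped s'
  argmin-dropped (s∈N , α-min) (βs<αs , βs≤t) (s'∈N , β-min) =
    ≤-<-trans βs'≤βs (<-≤-trans βs<αs (α-min _ s'∈N)) , ≤-trans βs'≤βs βs≤t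
    where βs'≤βs = β-min _ s∈N

  balancedRow-sumOver-≤ : ∀ {N r r'} → IsBalancedRow N α r → IsBalancedRow N β r' →
    sumOver r ≤ sumOver r'
  balancedRow-sumOver-≤ {r = r} {r'} R R' with any? (λ s → dropped? s ×-dec (0ℚ <? r s))
  ... | yes (s , dropped , r>0) = begin
    sumOver r    ≤⟨ sumOver-≤-sumFin (λ s' _ → nonneg R s') ⟩
    sumFin k r   ≡⟨ trans (total R) (sym (total R')) ⟩
    sumFin k r'  ≤⟨ sumFin-≤-sumOver (λ s' ¬dropped → ≮⇒≥ (¬dropped ∘ r'>0⇒dropped s')) ⟩
    sumOver r'   ∎
    where
    open ≤-Reasoning
    r'>0⇒dropped : ∀ s' → 0ℚ < r' s' → Dropped s'
    r'>0⇒dropped s' = argmin-dropped (argmin R s r>0) dropped ∘ argmin R' s'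
  ... | no ¬touches = begin
    sumOver r           ≤⟨ sumOver-mono-≤ (λ s dropped → ≮⇒≥ (λ r>0 → ¬touches (s , dropped , r>0))) ⟩
    sumOver (λ _ → 0ℚ)  ≤⟨ sumOver-mono-≤ (λ s _ → nonneg R' s) ⟩
    sumOver r'          ∎
    where open ≤-Reasoning

  nothing-dropped : ∀ {n} {x y : Fin n → Fin k → ℚ} →
    (∀ s → sumFin n (λ c → x c s) ≡ α s) → (∀ s → sumFin n (λ c → y c s) ≡ β s) →
    (∀ c → sumOver (x c) ≤ sumOver (y c)) → ∀ s → ¬ Dropped s
  nothing-dropped x-loads y-loads x≤y s dropped =
    <-irrefl refl (<-≤-trans (sumOver-mono-< (λ _ → proj₁) dropped)
                             (sumOver-loads-≤ x-loads y-loads x≤y))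

module Extension (adj' : Graph (suc m) k) {αold αnew : Fin k → ℚ}
  (old : IsBalancedServerFlow (λ i → adj' (suc i)) αold)
  (new : IsBalancedServerFlow adj' αnew)
  where

  padded : Fin (suc m) → Fin k → ℚ
  padded zero    = λ _ → 0ℚ
  padded (suc i) = flow old i

  padded-loads : ∀ s → sumFin (suc m) (λ c → padded c s) ≡ αold s
  padded-loads s = trans (+-identityˡ _) (flow-loads old s)

  old≤new : ∀ s → αold s ≤ αnew s
  old≤new s = ≮⇒≥ λ new<old →
    nothing-dropped padded-loads (flow-loads new) per-client s (new<old , ≤-refl)
    where
    open LoadDrop αold αnew (αnew s)
    per-client : ∀ c → sumOver (padded c) ≤ sumOver (flow new c)
    per-client zero    = sumOver-mono-≤ (λ s' _ → nonneg (flow-row new zero) s')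
    per-client (suc i) = balancedRow-sumOver-≤ (flow-row old i) (flow-row new (suc i))

  new≤old : ∀ s → (∀ v → adj' zero v ≡ true → αold s < αold v) → αnew s ≤ αold s
  new≤old s lighter = ≮⇒≥ λ old<new →
    nothing-dropped (flow-loads new) padded-loads per-client s (old<new , ≤-refl)
    where
    open LoadDrop αnew αold (αold s)
    unreachable : ∀ s' → Dropped s' → ¬ 0ℚ < flow new zero s'
    unreachable s' (_ , s'≤s) x>0 =
      <-irrefl refl (<-≤-trans (lighter s' (proj₁ (argmin (flow-row new zero) s' x>0))) s'≤s)
    per-client : ∀ c → sumOver (flow new c) ≤ sumOver (padded c)
    per-client zero    = sumOver-mono-≤ (λ s' dropped → ≮⇒≥ (unreachable s' dropped))
    per-client (suc i) = balancedRow-sumOver-≤ (flow-row new (suc i)) (flow-row old i)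

-- The neighbour hypotheses only guarantee that the balanced flows exist.
lemma22 : ∀ (m k : ℕ) (adj' : Graph (suc m) k) →
    EveryClientHasNeighbour (λ i → adj' (suc i)) →
    (∃ λ (s : Fin k) → adj' zero s ≡ true) →
    (αold αnew : Fin k → ℚ) →
    IsBalancedServerFlow (λ i → adj' (suc i)) αold →
    IsBalancedServerFlow adj' αnew →
    ∀ (s : Fin k) → (∀ v → adj' zero v ≡ true → αold s < αold v) →
    αnew s ≡ αold s
lemma22 m k adj' _ _ αold αnew old new s lighter = ≤-antisym (new≤old s lighter) (old≤new s)
  where open Extension adj' old new
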